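{- Let $n\ge 2$ targets $\mathcal T=\{1,\dots,n\}$ be given with travel times $c(u,v)>0$ ($u\ne v$) satisfying the triangle inequality. Let $k>n$ not be an integral multiple of $n$, and write $k=pn+q$ with integers $p\ge1$ and $1\le q\le n-1$. Then $\mathcal R^*(k)\le \mathcal R^*\!\left(n+\lceil q/p\rceil\right)$.
   Context: Targets $\mathcal T=\{1,\dots,n\}$, $n\ge 2$; travel times $c(u,v)>0$ for distinct $u,v\in\mathcal T$ (set $c(u,u)=0$), satisfying $c(u,v)+c(v,w)\ge c(u,w)$ for all $u,v,w\in\mathcal T$. For an integer $k\ge n$, a closed walk with $k$ visits is a sequence $\mathcal W=(v_1,\dots,v_{k+1})$ of targets with $v_{k+1}=v_1$, $v_i\ne v_{i+1}$ for $1\le i\le k$, and every target appearing among $v_1,\dots,v_k$. The walk is repeated forever: extend it to the infinite periodic sequence $(v_i)_{i\ge 1}$ with $v_{i+k}=v_i$, where moving from $v_i$ to $v_{i+1}$ takes time $c(v_i,v_{i+1})$. For a target $d$, the revisit time $RT(d,\mathcal W)$ is the maximum, over all pairs of indices $i<j$ with $v_i=v_j=d$ and $v_l\ne d$ for $i<l<j$, of $\sum_{l=i}^{j-1}c(v_l,v_{l+1})$. The revisit time of the walk is $\mathcal R(\mathcal W)=\max_{d\in\mathcal T}RT(d,\mathcal W)$, and $\mathcal R^*(k)$ is the minimum of $\mathcal R(\mathcal W)$ over all closed walks with $k$ visits (with the convention $\mathcal R^*(k)=+\infty$ if no such walk exists).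
   Formalization: The travel times $c(u,v)$ take values in the rationals. -}

module Defs where

open import Data.Nat as ℕ using (ℕ; zero; suc; _<_)
open import Data.Nat.DivMod using (_/_)
open import Data.Fin using (Fin)
open import Data.Fin.Properties using (_≟_)
open import Data.List using (List; foldr; upTo)
open import Data.List.Base using (allFin)
open import Data.Rational using (ℚ; 0ℚ; _+_; _⊔_)
open import Data.Product using (∃; _×_)
open import Relation.Nullary using (¬_; yes; no)
open import Relation.Binary.PropositionalEquality using (_≡_)

-- ⌈ q / p ⌉ for natural numbers (p = 0 is never used; returns 0)
ceilDiv : ℕ → ℕ → ℕ
ceilDiv q zero    = 0
ceilDiv q (suc p) = (q ℕ.+ p) / suc p

TravelTimes : ℕ → Set
TravelTimes n = Fin n → Fin n → ℚ

-- A closed walk with k visits, presented (as in the paper) through its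
-- infinite periodic extension v : ℕ → Fin n (index i here = paper's i+1):
-- period k, consecutive targets distinct for 1 ≤ i ≤ k, and every target
-- appears among the first k entries.
record ClosedWalk (n k : ℕ) : Set where
  field
    v        : ℕ → Fin n
    periodic : ∀ i → v (i ℕ.+ k) ≡ v i
    adjacent : ∀ i → i < k → ¬ (v i ≡ v (suc i))
    covers   : ∀ (d : Fin n) → ∃ λ i → i < k × v i ≡ d

module _ {n k : ℕ} (c : TravelTimes n) (W : ClosedWalk n k) where
  open ClosedWalk W

  gapFrom : ℕ → ℕ → Fin n → ℚ
  gapFrom zero    pos d = 0ℚ
  gapFrom (suc f) pos d with v (suc pos) ≟ d
  ... | yes _ = c (v pos) (v (suc pos))
  ... | no  _ = c (v pos) (v (suc pos)) + gapFrom f (suc pos) d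

  -- travel time from the visit at position i to the next visit of the
  -- same target (at most k steps later, by periodicity)
  gap : ℕ → ℚ
  gap i = gapFrom k i (v i)

  -- RT(d, W): maximum over consecutive visits of d (by periodicity it
  -- suffices to consider starting positions 0 ≤ i < k)
  RT : Fin n → ℚ
  RT d = foldr step 0ℚ (upTo k)
    where
    step : ℕ → ℚ → ℚ
    step i acc with v i ≟ d
    ... | yes _ = gap i ⊔ acc
    ... | no  _ = acc

  revisitTime : ℚ
  revisitTime = foldr (λ d acc → RT d ⊔ acc) 0ℚ (allFin n)

{-# OPTIONS --safe #-}
-- Let m = n + ⌈q/p⌉ and let W′ be a closed walk with m visits. Since m < 2n,
-- some target is visited only once per period of W′, so R(W′) is at least the
-- length L of a period. Since m > n, and W′ cannot just alternate between two
-- targets, some visit of W′ can be dropped: its two neighbours differ and its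
-- target recurs within the period. Rotate W′ so that this visit comes last,
-- run it p times and drop the visit in the first s = p⌈q/p⌉ − q < p rounds:
-- this is a closed walk with pm − s = k visits. Each of its revisits shortcuts
-- a stretch of at most one period of W′, so by the triangle inequality all its
-- revisit times are at most L.
module Submission where

open import Defs
open import Data.Nat using (ℕ; zero; suc; _+_; _*_; _∸_; _⊓_; _<_; _≤_; z≤n; s≤s; _≤?_; _<?_; NonZero; >-nonZero)
open import Data.Nat.Properties using (anyUpTo?)
import Data.Nat.Properties as ℕ
open import Data.Nat.DivMod
open import Data.Nat.Divisibility using (n∣m*n)
open import Data.Nat.Tactic.RingSolver using (solve-∀)
open import Data.Fin using (Fin; zero; suc; toℕ; fromℕ<; splitAt; join)
import Data.Fin.Properties as Fin
open import Data.Rational using (ℚ; 0ℚ; _⊔_) renaming (_<_ to _<ℚ_; _≤_ to _≤ℚ_; _+_ to _+ℚ_)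
import Data.Rational.Properties as ℚ
open import Algebra.Properties.Group ℚ.+-0-group using (∙-cancelˡ)
open import Data.Product using (∃; _×_; _,_; proj₁; proj₂)
open import Data.Sum using (_⊎_; inj₁; inj₂; [_,_]′; reduce)
import Data.Sum
open import Function using (_∘_)
open import Data.List using (List; []; _∷_; foldr; upTo; allFin)
open import Data.List.Membership.Propositional using (_∈_)
open import Data.List.Membership.Propositional.Properties using (∈-upTo⁺; ∈-upTo⁻; ∈-allFin)
open import Data.List.Relation.Unary.Any using (here; there)
open import Data.Empty using (⊥; ⊥-elim)
open import Relation.Nullary using (¬_; yes; no; Dec; ¬?)
open import Relation.Nullary.Decidable using (_×-dec_)
open import Relation.Binary.PropositionalEquality

p≤p+q : ∀ p {q} → 0ℚ ≤ℚ q → p ≤ℚ p +ℚ q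
p≤p+q p 0≤q = ℚ.≤-trans (ℚ.≤-reflexive (sym (ℚ.+-identityʳ p))) (ℚ.+-monoʳ-≤ p 0≤q)

∸-telescope : ∀ {a b c} → a ≤ b → b ≤ c → (b ∸ a) + (c ∸ b) ≡ c ∸ a
∸-telescope {a} {b} {c} a≤b b≤c = begin
  (b ∸ a) + (c ∸ b)            ≡⟨ ℕ.m+n∸m≡n a _ ⟨
  a + ((b ∸ a) + (c ∸ b)) ∸ a  ≡⟨ cong (_∸ a) (ℕ.+-assoc a (b ∸ a) (c ∸ b)) ⟨
  a + (b ∸ a) + (c ∸ b) ∸ a    ≡⟨ cong (λ x → x + (c ∸ b) ∸ a) (ℕ.m+[n∸m]≡n a≤b) ⟩
  b + (c ∸ b) ∸ a              ≡⟨ cong (_∸ a) (ℕ.m+[n∸m]≡n b≤c) ⟩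
  c ∸ a                        ∎
  where open ≡-Reasoning

foldr-≤ : ∀ {A : Set} (f : A → ℚ → ℚ) {z L : ℚ} (xs : List A) →
          (∀ x {a} → x ∈ xs → a ≤ℚ L → f x a ≤ℚ L) → z ≤ℚ L → foldr f z xs ≤ℚ L
foldr-≤ f []       f≤ z≤L = z≤L
foldr-≤ f (x ∷ xs) f≤ z≤L = f≤ x (here refl) (foldr-≤ f xs (λ y y∈xs → f≤ y (there y∈xs)) z≤L)

≤-foldr : ∀ {A : Set} (f : A → ℚ → ℚ) {z b : ℚ} {x : A} {xs : List A} →
          (∀ y a → a ≤ℚ f y a) → (∀ a → b ≤ℚ f x a) → x ∈ xs → b ≤ℚ foldr f z xs
≤-foldr f inflationary b≤f (here refl) = b≤f _
≤-foldr f inflationary b≤f (there x∈xs) =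
  ℚ.≤-trans (≤-foldr f inflationary b≤f x∈xs) (inflationary _ _)

module _ {n : ℕ} (c : TravelTimes n) where

  pathLength : (ℕ → Fin n) → ℕ → ℕ → ℚ
  pathLength w a zero    = 0ℚ
  pathLength w a (suc l) = c (w a) (w (suc a)) +ℚ pathLength w (suc a) l

  pathLength-+ : ∀ w a l₁ l₂ →
                 pathLength w a (l₁ + l₂) ≡ pathLength w a l₁ +ℚ pathLength w (a + l₁) l₂
  pathLength-+ w a zero l₂ rewrite ℕ.+-identityʳ a = sym (ℚ.+-identityˡ _)
  pathLength-+ w a (suc l₁) l₂ rewrite ℕ.+-suc a l₁ =
    trans (cong (c (w a) (w (suc a)) +ℚ_) (pathLength-+ w (suc a) l₁ l₂))
          (sym (ℚ.+-assoc (c (w a) (w (suc a))) (pathLength w (suc a) l₁) _))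

  pathLength-shift : ∀ w r a l → pathLength (λ i → w (i + r)) a l ≡ pathLength w (a + r) l
  pathLength-shift w r a zero    = refl
  pathLength-shift w r a (suc l) =
    cong (c (w (a + r)) (w (suc a + r)) +ℚ_) (pathLength-shift w r (suc a) l)

  module _ {w : ℕ → Fin n} {m : ℕ} (periodic : ∀ i → w (i + m) ≡ w i) where

    pathLength-periodic : ∀ a l → pathLength w (a + m) l ≡ pathLength w a l
    pathLength-periodic a zero = refl
    pathLength-periodic a (suc l) rewrite periodic a | periodic (suc a) =
      cong (c (w a) (w (suc a)) +ℚ_) (pathLength-periodic (suc a) l)

    -- Split a stretch of m + 1 steps at its first and at its last step; these
    -- two steps are equal by periodicity and cancel.
    pathLength-rotate : ∀ a → pathLength w a m ≡ pathLength w 0 m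
    pathLength-rotate zero    = refl
    pathLength-rotate (suc a) =
      trans (∙-cancelˡ (pathLength w a 1) (pathLength w (suc a) m) (pathLength w a m) split)
            (pathLength-rotate a)
      where
      open ≡-Reasoning
      split : pathLength w a 1 +ℚ pathLength w (suc a) m ≡ pathLength w a 1 +ℚ pathLength w a m
      split = begin
        pathLength w a 1 +ℚ pathLength w (suc a) m   ≡⟨ cong (λ b → pathLength w a 1 +ℚ pathLength w b m) (ℕ.+-comm a 1) ⟨
        pathLength w a 1 +ℚ pathLength w (a + 1) m   ≡⟨ pathLength-+ w a 1 m ⟨
        pathLength w a (1 + m)                       ≡⟨ cong (pathLength w a) (ℕ.+-comm 1 m) ⟩
        pathLength w a (m + 1)                       ≡⟨ pathLength-+ w a m 1 ⟩
        pathLength w a m +ℚ pathLength w (a + m) 1   ≡⟨ cong (pathLength w a m +ℚ_) (pathLength-periodic a 1) ⟩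
        pathLength w a m +ℚ pathLength w a 1         ≡⟨ ℚ.+-comm (pathLength w a m) (pathLength w a 1) ⟩
        pathLength w a 1 +ℚ pathLength w a m         ∎

  module _ (c-nonneg : ∀ x y → 0ℚ ≤ℚ c x y) where

    pathLength-nonneg : ∀ w a l → 0ℚ ≤ℚ pathLength w a l
    pathLength-nonneg w a zero    = ℚ.≤-refl
    pathLength-nonneg w a (suc l) =
      ℚ.≤-trans (c-nonneg (w a) (w (suc a))) (p≤p+q _ (pathLength-nonneg w (suc a) l))

    pathLength-mono : ∀ w a {l₁ l₂} → l₁ ≤ l₂ → pathLength w a l₁ ≤ℚ pathLength w a l₂
    pathLength-mono w a {l₁} {l₂} l₁≤l₂ = begin
      pathLength w a l₁                                      ≤⟨ p≤p+q _ (pathLength-nonneg w (a + l₁) (l₂ ∸ l₁)) ⟩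
      pathLength w a l₁ +ℚ pathLength w (a + l₁) (l₂ ∸ l₁)  ≡⟨ pathLength-+ w a l₁ (l₂ ∸ l₁) ⟨
      pathLength w a (l₁ + (l₂ ∸ l₁))                        ≡⟨ cong (pathLength w a) (ℕ.m+[n∸m]≡n l₁≤l₂) ⟩
      pathLength w a l₂                                      ∎
      where open ℚ.≤-Reasoning

  module _ (c-refl : ∀ x → c x x ≡ 0ℚ) (triangle : ∀ x y z → c x z ≤ℚ c x y +ℚ c y z) where

    c≤pathLength : ∀ w a l → c (w a) (w (a + l)) ≤ℚ pathLength w a l
    c≤pathLength w a zero rewrite ℕ.+-identityʳ a = ℚ.≤-reflexive (c-refl (w a))
    c≤pathLength w a (suc l) rewrite ℕ.+-suc a l =
      ℚ.≤-trans (triangle (w a) (w (suc a)) (w (suc a + l)))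
                (ℚ.+-monoʳ-≤ (c (w a) (w (suc a))) (c≤pathLength w (suc a) l))

  module _ (c-nonneg : ∀ x y → 0ℚ ≤ℚ c x y) (c-refl : ∀ x → c x x ≡ 0ℚ)
           (triangle : ∀ x y z → c x z ≤ℚ c x y +ℚ c y z) where

    pathLength-subsequence :
      ∀ {w u : ℕ → Fin n} (f : ℕ → ℕ) → (∀ {a b} → a ≤ b → f a ≤ f b) →
      ∀ x t → (∀ l → l ≤ x + t → w l ≡ u (f l)) →
      pathLength w x t ≤ℚ pathLength u (f x) (f (x + t) ∸ f x)
    pathLength-subsequence {w} {u} f f-mono x zero w≡u∘f =
      pathLength-nonneg c-nonneg u (f x) (f (x + 0) ∸ f x)
    pathLength-subsequence {w} {u} f f-mono x (suc t) w≡u∘f = begin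
      c (w x) (w (suc x)) +ℚ pathLength w (suc x) t
        ≤⟨ ℚ.+-mono-≤ first-step rest ⟩
      pathLength u (f x) d₁ +ℚ pathLength u (f x + d₁) d₂
        ≡⟨ pathLength-+ u (f x) d₁ d₂ ⟨
      pathLength u (f x) (d₁ + d₂)
        ≡⟨ cong (pathLength u (f x)) (∸-telescope (f-mono (ℕ.n≤1+n x)) (f-mono (ℕ.m≤m+n (suc x) t))) ⟩
      pathLength u (f x) (f (suc x + t) ∸ f x)
        ≡⟨ cong (λ y → pathLength u (f x) (f y ∸ f x)) (ℕ.+-suc x t) ⟨
      pathLength u (f x) (f (x + suc t) ∸ f x)
        ∎
      where
      open ℚ.≤-Reasoning
      d₁ d₂ : ℕ
      d₁ = f (suc x) ∸ f x
      d₂ = f (suc x + t) ∸ f (suc x)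
      f[x]+d₁≡f[1+x] : f x + d₁ ≡ f (suc x)
      f[x]+d₁≡f[1+x] = ℕ.m+[n∸m]≡n (f-mono (ℕ.n≤1+n x))
      in-range : ∀ l → l ≤ suc x + t → l ≤ x + suc t
      in-range l l≤ = ℕ.≤-trans l≤ (ℕ.≤-reflexive (sym (ℕ.+-suc x t)))
      first-step : c (w x) (w (suc x)) ≤ℚ pathLength u (f x) d₁
      first-step = subst₂ (λ a b → c a b ≤ℚ pathLength u (f x) d₁)
        (sym (w≡u∘f x (ℕ.m≤m+n x (suc t))))
        (trans (cong u f[x]+d₁≡f[1+x]) (sym (w≡u∘f (suc x) (in-range (suc x) (ℕ.m≤m+n (suc x) t)))))
        (c≤pathLength c-refl triangle u (f x) d₁)
      rest : pathLength w (suc x) t ≤ℚ pathLength u (f x + d₁) d₂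
      rest = subst (λ a → pathLength w (suc x) t ≤ℚ pathLength u a d₂) (sym f[x]+d₁≡f[1+x])
        (pathLength-subsequence f f-mono (suc x) t (λ l l≤ → w≡u∘f l (in-range l l≤)))

module _ {n k : ℕ} (c : TravelTimes n) (W : ClosedWalk n k) where
  open ClosedWalk W

  gapFrom≤pathLength : (∀ x y → 0ℚ ≤ℚ c x y) →
                       ∀ F pos d t → 1 ≤ t → t ≤ F → v (pos + t) ≡ d →
                       gapFrom c W F pos d ≤ℚ pathLength c v pos t
  gapFrom≤pathLength c-nonneg (suc F) pos d (suc t) _ (s≤s t≤F) v[pos+t]≡d
    with v (suc pos) Fin.≟ d
  ... | yes _ = p≤p+q _ (pathLength-nonneg c c-nonneg v (suc pos) t)
  ... | no v[1+pos]≢d with t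
  ...   | zero   = ⊥-elim (v[1+pos]≢d (trans (cong v (ℕ.+-comm 1 pos)) v[pos+t]≡d))
  ...   | suc t′ = ℚ.+-monoʳ-≤ (c (v pos) (v (suc pos)))
                     (gapFrom≤pathLength c-nonneg F (suc pos) d (suc t′) (s≤s z≤n) t≤F
                        (trans (cong v (sym (ℕ.+-suc pos (suc t′)))) v[pos+t]≡d))

  pathLength≤gapFrom : ∀ F pos d → (∀ t → 1 ≤ t → t < F → ¬ v (pos + t) ≡ d) →
                       pathLength c v pos F ≤ℚ gapFrom c W F pos d
  pathLength≤gapFrom zero pos d _ = ℚ.≤-refl
  pathLength≤gapFrom (suc F) pos d not-before with v (suc pos) Fin.≟ d
  pathLength≤gapFrom (suc zero)    pos d not-before | yes _ = ℚ.≤-reflexive (ℚ.+-identityʳ _)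
  pathLength≤gapFrom (suc (suc F)) pos d not-before | yes v[1+pos]≡d =
    ⊥-elim (not-before 1 (s≤s z≤n) (s≤s (s≤s z≤n)) (trans (cong v (ℕ.+-comm pos 1)) v[1+pos]≡d))
  pathLength≤gapFrom (suc F) pos d not-before | no _ =
    ℚ.+-monoʳ-≤ (c (v pos) (v (suc pos)))
      (pathLength≤gapFrom F (suc pos) d λ t 1≤t t<F v[1+pos+t]≡d →
         not-before (suc t) (s≤s z≤n) (s≤s t<F) (trans (cong v (ℕ.+-suc pos t)) v[1+pos+t]≡d))

  private
    foldr-step : ∀ {f : ℕ → ℚ → ℚ} {z xs} → foldr f z xs ≡ foldr f z xs → ℕ → ℚ → ℚ
    foldr-step {f} _ = f

    -- `RT` folds a function local to its `where` block, which cannot be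
    -- named from outside; it is recovered here by unification.
    RT-step : Fin n → ℕ → ℚ → ℚ
    RT-step d = foldr-step {xs = upTo k} (refl {x = RT c W d})

    RT-step-inflationary : ∀ d i a → a ≤ℚ RT-step d i a
    RT-step-inflationary d i a with v i Fin.≟ d
    ... | yes _ = ℚ.p≤q⊔p (gap c W i) a
    ... | no  _ = ℚ.≤-refl

    gap≤RT-step : ∀ i a → gap c W i ≤ℚ RT-step (v i) i a
    gap≤RT-step i a with v i Fin.≟ v i
    ... | yes _        = ℚ.p≤p⊔q (gap c W i) a
    ... | no  v[i]≢v[i] = ⊥-elim (v[i]≢v[i] refl)

    RT-step-≤ : ∀ {L} → (∀ i → i < k → gap c W i ≤ℚ L) →
                ∀ d i {a} → i ∈ upTo k → a ≤ℚ L → RT-step d i a ≤ℚ L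
    RT-step-≤ gap≤L d i i∈ a≤L with v i Fin.≟ d
    ... | yes _ = ℚ.⊔-lub (gap≤L i (∈-upTo⁻ i∈)) a≤L
    ... | no  _ = a≤L

  revisitTime-≤ : ∀ {L} → 0ℚ ≤ℚ L → (∀ i → i < k → gap c W i ≤ℚ L) → revisitTime c W ≤ℚ L
  revisitTime-≤ {L} 0≤L gap≤L =
    foldr-≤ (λ d acc → RT c W d ⊔ acc) (allFin n) (λ d _ acc≤L → ℚ.⊔-lub (RT≤ d) acc≤L) 0≤L
    where
    RT≤ : ∀ d → RT c W d ≤ℚ L
    RT≤ d = foldr-≤ (RT-step d) (upTo k) (RT-step-≤ gap≤L d) 0≤L

  gap≤revisitTime : ∀ i → i < k → gap c W i ≤ℚ revisitTime c W
  gap≤revisitTime i i<k =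
    ≤-foldr (λ d acc → RT c W d ⊔ acc) (λ d acc → ℚ.p≤q⊔p (RT c W d) acc)
      (λ acc → ℚ.≤-trans gap≤RT (ℚ.p≤p⊔q (RT c W (v i)) acc)) (∈-allFin (v i))
    where
    gap≤RT : gap c W i ≤ℚ RT c W (v i)
    gap≤RT = ≤-foldr (RT-step (v i)) (RT-step-inflationary (v i)) (gap≤RT-step i) (∈-upTo⁺ i<k)

+-right-comm : ∀ a b c → a + b + c ≡ a + c + b
+-right-comm = solve-∀

injective-below⇒≤ : ∀ {k m} (g : Fin k → ℕ) → (∀ x → g x < m) →
                    (∀ {x y} → g x ≡ g y → x ≡ y) → k ≤ m
injective-below⇒≤ {k} {m} g g<m g-injective = Fin.injective⇒≤ {f = g′} g′-injective
  where
  g′ : Fin k → Fin m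
  g′ x = fromℕ< (g<m x)
  g′-injective : ∀ {x y} → g′ x ≡ g′ y → x ≡ y
  g′-injective {x} {y} eq = g-injective (begin
    g x           ≡⟨ Fin.toℕ-fromℕ< (g<m x) ⟨
    toℕ (g′ x)    ≡⟨ cong toℕ eq ⟩
    toℕ (g′ y)    ≡⟨ Fin.toℕ-fromℕ< (g<m y) ⟩
    g y           ∎)
    where open ≡-Reasoning

disjoint-sections⇒≤ : ∀ {n m} {v : ℕ → Fin n} (f g : Fin n → ℕ) →
                      (∀ d → f d < m) → (∀ d → g d < m) → (∀ d → v (f d) ≡ d) → (∀ d → v (g d) ≡ d) →
                      (∀ d → ¬ f d ≡ g d) → n + n ≤ m
disjoint-sections⇒≤ {n} {m} {v} f g f<m g<m v[f] v[g] f≢g =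
  injective-below⇒≤ (h ∘ splitAt n) (h<m ∘ splitAt n) (splitAt-injective ∘ h-injective)
  where
  h : Fin n ⊎ Fin n → ℕ
  h = [ f , g ]′
  h<m : ∀ x → h x < m
  h<m (inj₁ d) = f<m d
  h<m (inj₂ d) = g<m d
  v[h] : ∀ x → v (h x) ≡ reduce x
  v[h] (inj₁ d) = v[f] d
  v[h] (inj₂ d) = v[g] d
  h-injective : ∀ {x y} → h x ≡ h y → x ≡ y
  h-injective {x} {y} eq with trans (sym (v[h] x)) (trans (cong v eq) (v[h] y))
  h-injective {inj₁ d} {inj₁ d′} eq | d≡d′ = cong inj₁ d≡d′
  h-injective {inj₂ d} {inj₂ d′} eq | d≡d′ = cong inj₂ d≡d′
  h-injective {inj₁ d} {inj₂ d′} eq | d≡d′ = ⊥-elim (f≢g d (trans eq (cong g (sym d≡d′))))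
  h-injective {inj₂ d} {inj₁ d′} eq | d≡d′ = ⊥-elim (f≢g d′ (trans (sym eq) (cong g d≡d′)))
  splitAt-injective : ∀ {x y} → splitAt n x ≡ splitAt n y → x ≡ y
  splitAt-injective {x} {y} eq =
    trans (sym (Fin.join-splitAt n n x)) (trans (cong (join n n) eq) (Fin.join-splitAt n n y))

covered-by-two⇒≤2 : ∀ {n} {a b : Fin n} → (∀ d → d ≡ a ⊎ d ≡ b) → n ≤ 2
covered-by-two⇒≤2 {n} {a} {b} a-or-b = Fin.injective⇒≤ {f = is-a} is-a-injective
  where
  is-a : Fin n → Fin 2
  is-a d with d Fin.≟ a
  ... | yes _ = zero
  ... | no  _ = suc zero
  is-a-injective : ∀ {x y} → is-a x ≡ is-a y → x ≡ y
  is-a-injective {x} {y} eq with x Fin.≟ a | y Fin.≟ a | a-or-b x | a-or-b y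
  ... | yes x≡a | yes y≡a | _        | _        = trans x≡a (sym y≡a)
  ... | no  x≢a | _       | inj₁ x≡a | _        = ⊥-elim (x≢a x≡a)
  ... | _       | no  y≢a | _        | inj₁ y≡a = ⊥-elim (y≢a y≡a)
  ... | no  _   | no  _   | inj₂ x≡b | inj₂ y≡b = trans x≡b (sym y≡b)

module _ {n M : ℕ} (W : ClosedWalk n (suc M)) where
  open ClosedWalk W

  private
    m : ℕ
    m = suc M

  periodic-* : ∀ j i → v (i + j * m) ≡ v i
  periodic-* zero    i = cong v (ℕ.+-identityʳ i)
  periodic-* (suc j) i = begin
    v (i + (m + j * m))  ≡⟨ cong v (shuffle i m (j * m)) ⟩
    v (i + j * m + m)    ≡⟨ periodic (i + j * m) ⟩
    v (i + j * m)        ≡⟨ periodic-* j i ⟩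
    v i                  ∎
    where
    open ≡-Reasoning
    shuffle : ∀ a b c → a + (b + c) ≡ a + c + b
    shuffle = solve-∀

  v-mod : ∀ i → v i ≡ v (i % m)
  v-mod i = trans (cong v (m≡m%n+[m/n]*n i m)) (periodic-* (i / m) (i % m))

  adjacent-everywhere : ∀ i → ¬ v i ≡ v (suc i)
  adjacent-everywhere i v[i]≡v[1+i] = adjacent (i % m) (m%n<n i m) (begin
    v (i % m)                        ≡⟨ v-mod i ⟨
    v i                              ≡⟨ v[i]≡v[1+i] ⟩
    v (suc i)                        ≡⟨ cong (λ j → v (suc j)) (m≡m%n+[m/n]*n i m) ⟩
    v (suc (i % m) + (i / m) * m)    ≡⟨ periodic-* (i / m) (suc (i % m)) ⟩
    v (suc (i % m))                  ∎)
    where open ≡-Reasoning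

  covers-window : ∀ B d → ∃ λ z → z < m × v (B + z) ≡ d
  covers-window zero d = covers d
  covers-window (suc B) d with covers-window B d
  ... | suc z , s≤s z<M , v[B+1+z]≡d =
    z , ℕ.m≤n⇒m≤1+n z<M , trans (cong v (sym (ℕ.+-suc B z))) v[B+1+z]≡d
  ... | zero  , _       , v[B+0]≡d  =
    M , ℕ.≤-refl , (begin
      v (suc B + M)   ≡⟨ cong v (ℕ.+-suc B M) ⟨
      v (B + m)       ≡⟨ periodic B ⟩
      v B             ≡⟨ cong v (ℕ.+-identityʳ B) ⟨
      v (B + 0)       ≡⟨ v[B+0]≡d ⟩
      d               ∎)
    where open ≡-Reasoning

  rotate : ℕ → ClosedWalk n m
  rotate r = record
    { v        = λ i → v (i + r)
    ; periodic = λ i → trans (cong v (+-right-comm i m r)) (periodic (i + r))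
    ; adjacent = λ i _ → adjacent-everywhere (i + r)
    ; covers   = covers-rotated
    }
    where
    covers-rotated : ∀ d → ∃ λ z → z < m × v (z + r) ≡ d
    covers-rotated d with covers-window r d
    ... | z , z<m , v[r+z]≡d = z , z<m , trans (cong v (ℕ.+-comm z r)) v[r+z]≡d

  Revisited : ℕ → Set
  Revisited i = ∃ λ t → t < m × 0 < t × v (i + t) ≡ v i

  revisited? : ∀ i → Dec (Revisited i)
  revisited? i = anyUpTo? (λ t → (0 <? t) ×-dec (v (i + t) Fin.≟ v i)) m

  revisited-+m : ∀ {i} → Revisited i → Revisited (i + m)
  revisited-+m {i} (t , t<m , 0<t , v[i+t]≡v[i]) = t , t<m , 0<t , (begin
    v (i + m + t)   ≡⟨ cong v (+-right-comm i m t) ⟩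
    v (i + t + m)   ≡⟨ periodic (i + t) ⟩
    v (i + t)       ≡⟨ v[i+t]≡v[i] ⟩
    v i             ≡⟨ periodic i ⟨
    v (i + m)       ∎)
    where open ≡-Reasoning

  other-occurrence : ∀ {i} → i < m → Revisited i → ∃ λ j → j < m × ¬ j ≡ i × v j ≡ v i
  other-occurrence {i} i<m (t , t<m , 0<t , v[i+t]≡v[i]) with i + t <? m
  ... | yes i+t<m = i + t , i+t<m , i+t≢i , v[i+t]≡v[i]
    where
    i+t≢i : ¬ i + t ≡ i
    i+t≢i eq = ℕ.<⇒≢ 0<t (sym (ℕ.+-cancelˡ-≡ i t 0 (trans eq (sym (ℕ.+-identityʳ i)))))
  ... | no  i+t≮m = i + t ∸ m , j<m , j≢i , trans (sym (periodic _)) (trans (cong v j+m≡i+t) v[i+t]≡v[i])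
    where
    m≤i+t : m ≤ i + t
    m≤i+t = ℕ.≮⇒≥ i+t≮m
    j+m≡i+t : i + t ∸ m + m ≡ i + t
    j+m≡i+t = ℕ.m∸n+n≡m m≤i+t
    j<m : i + t ∸ m < m
    j<m = ℕ.+-cancelʳ-< _ _ m (subst (_< m + m) (sym j+m≡i+t) (ℕ.+-mono-< i<m t<m))
    j≢i : ¬ i + t ∸ m ≡ i
    j≢i eq = ℕ.<⇒≢ t<m (ℕ.+-cancelˡ-≡ i t m (trans (sym j+m≡i+t) (cong (_+ m) eq)))

  -- If all visits were revisited, every target would have two positions in
  -- a period.
  ∃-unrevisited : m < n + n → ∃ λ i → i < m × ¬ Revisited i
  ∃-unrevisited m<2n with anyUpTo? (λ i → ¬? (revisited? i)) m
  ... | yes found = found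
  ... | no  none  = ⊥-elim (ℕ.<⇒≱ m<2n
                      (disjoint-sections⇒≤ {v = v} first second first<m second<m v[first] v[second] first≢second))
    where
    first : Fin n → ℕ
    first d = proj₁ (covers d)
    first<m : ∀ d → first d < m
    first<m d = proj₁ (proj₂ (covers d))
    v[first] : ∀ d → v (first d) ≡ d
    v[first] d = proj₂ (proj₂ (covers d))
    revisited : ∀ d → Revisited (first d)
    revisited d with revisited? (first d)
    ... | yes r = r
    ... | no ¬r = ⊥-elim (none (first d , first<m d , ¬r))
    second : Fin n → ℕ
    second d = proj₁ (other-occurrence (first<m d) (revisited d))
    second<m : ∀ d → second d < m
    second<m d = proj₁ (proj₂ (other-occurrence (first<m d) (revisited d)))
    first≢second : ∀ d → ¬ first d ≡ second d
    first≢second d eq = proj₁ (proj₂ (proj₂ (other-occurrence (first<m d) (revisited d)))) (sym eq)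
    v[second] : ∀ d → v (second d) ≡ d
    v[second] d = trans (proj₂ (proj₂ (proj₂ (other-occurrence (first<m d) (revisited d))))) (v[first] d)

  -- Droppable e: the visit at position suc e (not e) can be omitted.
  Droppable : ℕ → Set
  Droppable e = ¬ v e ≡ v (suc (suc e)) × Revisited (suc e)

  droppable? : ∀ e → Dec (Droppable e)
  droppable? e = ¬? (v e Fin.≟ v (suc (suc e))) ×-dec revisited? (suc e)

  two-apart⇒revisited : 3 ≤ m → ∀ {e} → v e ≡ v (suc (suc e)) → Revisited (suc (suc e))
  two-apart⇒revisited (s≤s 2≤M) {e} v[e]≡v[2+e] =
    M ∸ 1 , s≤s (ℕ.m∸n≤m M 1) , ℕ.m<n⇒0<n∸m 2≤M , (begin
      v (suc (suc e) + (M ∸ 1))   ≡⟨ cong v (shuffle e (M ∸ 1)) ⟩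
      v (e + suc (suc (M ∸ 1)))   ≡⟨ cong (λ x → v (e + suc x)) (ℕ.m+[n∸m]≡n (ℕ.<⇒≤ 2≤M)) ⟩
      v (e + m)                   ≡⟨ periodic e ⟩
      v e                         ≡⟨ v[e]≡v[2+e] ⟩
      v (suc (suc e))             ∎)
    where
    open ≡-Reasoning
    shuffle : ∀ a b → suc (suc a) + b ≡ a + suc (suc b)
    shuffle = solve-∀

  -- Without a droppable visit in a window, revisits propagate along it, so
  -- the walk alternates there.
  alternating : 3 ≤ m → ∀ {e₀} → Revisited (suc e₀) → (∀ x → x < m → ¬ Droppable (e₀ + x)) →
                ∀ x → x < m → v (e₀ + x) ≡ v (suc (suc (e₀ + x)))
  alternating 3≤m {e₀} r₀ none y y<m = two-apart-of y y<m (revisited-along y y<m)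
    where
    two-apart-of : ∀ x → x < m → Revisited (suc (e₀ + x)) → v (e₀ + x) ≡ v (suc (suc (e₀ + x)))
    two-apart-of x x<m r with v (e₀ + x) Fin.≟ v (suc (suc (e₀ + x)))
    ... | yes eq = eq
    ... | no  ne = ⊥-elim (none x x<m (ne , r))
    revisited-along : ∀ x → x < m → Revisited (suc (e₀ + x))
    revisited-along zero    _     = subst (λ y → Revisited (suc y)) (sym (ℕ.+-identityʳ e₀)) r₀
    revisited-along (suc x) 1+x<m = subst (λ y → Revisited (suc y)) (sym (ℕ.+-suc e₀ x))
      (two-apart⇒revisited 3≤m (two-apart-of x x<m (revisited-along x x<m)))
      where
      x<m : x < m
      x<m = ℕ.<-trans (ℕ.n<1+n x) 1+x<m

  ∃-revisited : n < m → ∃ λ e → Revisited (suc e)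
  ∃-revisited n<m with Fin.pigeonhole n<m (λ i → v (toℕ i))
  ... | i , j , i<j , v[i]≡v[j] =
    toℕ i + M , subst Revisited (ℕ.+-suc (toℕ i) M) (revisited-+m r)
    where
    r : Revisited (toℕ i)
    r = toℕ j ∸ toℕ i , ℕ.≤-<-trans (ℕ.m∸n≤m (toℕ j) (toℕ i)) (Fin.toℕ<n j) , ℕ.m<n⇒0<n∸m i<j ,
        trans (cong v (ℕ.m+[n∸m]≡n (ℕ.<⇒≤ i<j))) (sym v[i]≡v[j])

  -- Otherwise the walk alternates between two targets, which is impossible
  -- for more than two targets and for period 3.
  ∃-droppable : n < m → 2 < n ⊎ m ≡ 3 → ∃ Droppable
  ∃-droppable n<m 2<n∨m≡3 with ∃-revisited n<m
  ... | e₀ , r₀ with anyUpTo? (λ x → droppable? (e₀ + x)) m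
  ...   | yes (x , _ , droppable) = e₀ + x , droppable
  ...   | no  none = ⊥-elim (not-alternating 2<n∨m≡3)
    where
    3≤m : 3 ≤ m
    3≤m = [ (λ 2<n → ℕ.<-trans 2<n n<m) , (λ m≡3 → ℕ.≤-reflexive (sym m≡3)) ]′ 2<n∨m≡3
    two-apart : ∀ x → x < m → v (e₀ + x) ≡ v (suc (suc (e₀ + x)))
    two-apart = alternating 3≤m r₀ (λ x x<m droppable → none (x , x<m , droppable))
    two-values : ∀ x → x < m → v (e₀ + x) ≡ v e₀ ⊎ v (e₀ + x) ≡ v (suc e₀)
    two-values zero          _     = inj₁ (cong v (ℕ.+-identityʳ e₀))
    two-values (suc zero)    _     = inj₂ (cong v (ℕ.+-comm e₀ 1))
    two-values (suc (suc x)) 2+x<m =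
      Data.Sum.map (trans (sym shifted)) (trans (sym shifted)) (two-values x x<m)
      where
      x<m : x < m
      x<m = ℕ.<-trans (ℕ.n<1+n x) (ℕ.<-trans (ℕ.n<1+n (suc x)) 2+x<m)
      shifted : v (e₀ + x) ≡ v (e₀ + suc (suc x))
      shifted = trans (two-apart x x<m)
        (cong v (sym (trans (ℕ.+-suc e₀ (suc x)) (cong suc (ℕ.+-suc e₀ x)))))
    not-alternating : 2 < n ⊎ m ≡ 3 → ⊥
    not-alternating (inj₁ 2<n) = ℕ.<⇒≱ 2<n (covered-by-two⇒≤2 λ d →
      let z , z<m , v[e₀+z]≡d = covers-window e₀ d in
      Data.Sum.map (trans (sym v[e₀+z]≡d)) (trans (sym v[e₀+z]≡d)) (two-values z z<m))
    not-alternating (inj₂ refl) = adjacent-everywhere e₀ (begin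
      v e₀                    ≡⟨ periodic e₀ ⟨
      v (e₀ + 3)              ≡⟨ cong v (ℕ.+-suc e₀ 2) ⟩
      v (suc (e₀ + 2))        ≡⟨ cong v (cong suc (ℕ.+-comm e₀ 2)) ⟩
      v (suc (suc (suc e₀)))  ≡⟨ cong v (cong (λ y → suc (suc y)) (ℕ.+-comm e₀ 1)) ⟨
      v (suc (suc (e₀ + 1)))  ≡⟨ two-apart 1 (s≤s (s≤s z≤n)) ⟨
      v (e₀ + 1)              ≡⟨ cong v (ℕ.+-comm e₀ 1) ⟩
      v (suc e₀)              ∎)
      where open ≡-Reasoning

  droppable-+m : ∀ {e} → Droppable e → Droppable (e + m)
  droppable-+m {e} (v[e]≢v[2+e] , r) =
    (λ eq → v[e]≢v[2+e] (trans (sym (periodic e)) (trans eq (periodic (suc (suc e)))))) ,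
    revisited-+m r

droppable-rotate : ∀ {n M} (W : ClosedWalk n (suc M)) {e r} →
                   Droppable W (e + r) → Droppable (rotate W r) e
droppable-rotate W {e} {r} (v[e+r]≢v[2+e+r] , t , t<m , 0<t , v[1+e+r+t]≡v[1+e+r]) =
  v[e+r]≢v[2+e+r] , t , t<m , 0<t ,
  trans (cong (ClosedWalk.v W) (+-right-comm (suc e) t r)) v[1+e+r+t]≡v[1+e+r]

period≤gap : ∀ {n M} (c : TravelTimes n) (W : ClosedWalk n (suc M)) {i} → ¬ Revisited W i →
             pathLength c (ClosedWalk.v W) i (suc M) ≤ℚ gap c W i
period≤gap c W {i} ¬revisited = pathLength≤gapFrom c W _ i (ClosedWalk.v W i)
  λ t 0<t t<m v[i+t]≡v[i] → ¬revisited (t , t<m , 0<t , v[i+t]≡v[i])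

-- Each gap of W shortcuts a stretch of at most one period of u.
revisitTime≤period :
  ∀ {n k m} (c : TravelTimes n) → (∀ x y → 0ℚ ≤ℚ c x y) → (∀ x → c x x ≡ 0ℚ) →
  (∀ x y z → c x z ≤ℚ c x y +ℚ c y z) →
  (W : ClosedWalk n k) {u : ℕ → Fin n} → (∀ i → u (i + m) ≡ u i) →
  (f : ℕ → ℕ) → (∀ {a b} → a ≤ b → f a ≤ f b) →
  (∀ {l} → l ≤ k + k → ClosedWalk.v W l ≡ u (f l)) →
  (∀ i → i < k → ∃ λ t → 0 < t × t ≤ k × ClosedWalk.v W (i + t) ≡ ClosedWalk.v W i × f (i + t) ≤ f i + m) →
  revisitTime c W ≤ℚ pathLength c u 0 m
revisitTime≤period {k = k} {m} c c-nonneg c-refl triangle W {u} u-periodic f f-mono W≡u∘f revisits =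
  revisitTime-≤ c W (pathLength-nonneg c c-nonneg u 0 m) gap≤period
  where
  open ClosedWalk W
  gap≤period : ∀ i → i < k → gap c W i ≤ℚ pathLength c u 0 m
  gap≤period i i<k with revisits i i<k
  ... | t , 0<t , t≤k , v[i+t]≡v[i] , f[i+t]≤f[i]+m = begin
    gap c W i                               ≤⟨ gapFrom≤pathLength c W c-nonneg k i (v i) t 0<t t≤k v[i+t]≡v[i] ⟩
    pathLength c v i t                      ≤⟨ pathLength-subsequence c c-nonneg c-refl triangle f f-mono i t
                                                 (λ l l≤i+t → W≡u∘f (ℕ.≤-trans l≤i+t (ℕ.+-mono-≤ (ℕ.<⇒≤ i<k) t≤k))) ⟩
    pathLength c u (f i) (f (i + t) ∸ f i)  ≤⟨ pathLength-mono c c-nonneg u (f i) (ℕ.m≤n+o⇒m∸n≤o (f (i + t)) (f i) f[i+t]≤f[i]+m) ⟩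
    pathLength c u (f i) m                  ≡⟨ pathLength-rotate c u-periodic (f i) ⟩
    pathLength c u 0 m                      ∎
    where open ℚ.≤-Reasoning

module SkipMap (M₁ s : ℕ) where

  M m : ℕ
  M = suc M₁
  m = suc M

  -- Position in a walk of period m of the l-th visit of the walk that
  -- omits the last visit (index M) of each of its first s periods.
  skip : ℕ → ℕ
  skip l = l + (l / M ⊓ s)

  skip-mono : ∀ {a b} → a ≤ b → skip a ≤ skip b
  skip-mono a≤b = ℕ.+-mono-≤ a≤b (ℕ.⊓-monoˡ-≤ s (/-monoˡ-≤ M a≤b))

  skip-small : ∀ {l} → l < M → skip l ≡ l
  skip-small {l} l<M = trans (cong (λ q → l + q ⊓ s) (m<n⇒m/n≡0 l<M)) (ℕ.+-identityʳ l)

  skip-late : ∀ {l} → s * M ≤ l → skip l ≡ l + s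
  skip-late {l} sM≤l = cong (l +_) (ℕ.m≥n⇒m⊓n≡n (begin
    s             ≡⟨ m*n/n≡m s M ⟨
    s * M / M     ≤⟨ /-monoˡ-≤ M sM≤l ⟩
    l / M         ∎))
    where open ℕ.≤-Reasoning

  skip-early-+M : ∀ {l} → l < s * M → skip (l + M) ≡ skip l + m
  skip-early-+M {l} l<sM = begin
    l + M + ((l + M) / M ⊓ s)   ≡⟨ cong (λ q → l + M + q ⊓ s) next-quotient ⟩
    l + M + (suc q ⊓ s)         ≡⟨ cong (l + M +_) (ℕ.m≤n⇒m⊓n≡m q<s) ⟩
    l + M + suc q               ≡⟨ shuffle l M q ⟩
    l + q + m                   ≡⟨ cong (λ x → l + x + m) (ℕ.m≤n⇒m⊓n≡m (ℕ.<⇒≤ q<s)) ⟨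
    l + (q ⊓ s) + m             ∎
    where
    open ≡-Reasoning
    q : ℕ
    q = l / M
    q<s : q < s
    q<s = m<n*o⇒m/o<n l<sM
    next-quotient : (l + M) / M ≡ suc q
    next-quotient = trans (m/n≡1+[m∸n]/n (ℕ.m≤n+m M l)) (cong (λ x → suc (x / M)) (ℕ.m+n∸n≡m l M))
    shuffle : ∀ l M q → l + M + suc q ≡ l + q + suc M
    shuffle = solve-∀

  private
    block-end : ∀ {l} → suc (l % M) ≡ M → l ≡ M₁ + l / M * M
    block-end {l} 1+r≡M = trans (m≡m%n+[m/n]*n l M) (cong (_+ l / M * M) (ℕ.suc-injective 1+r≡M))

    quotient-after-block-end : ∀ {l} → suc (l % M) ≡ M → suc l / M ≡ suc (l / M)
    quotient-after-block-end {l} 1+r≡M =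
      trans (/-congˡ {o = M} (cong suc (block-end {l} 1+r≡M))) (m*n/n≡m (suc (l / M)) M)

    quotient-inside-block : ∀ {l} → suc (l % M) < M → suc l / M ≡ l / M
    quotient-inside-block {l} 1+r<M = begin
      suc l / M                         ≡⟨ /-congˡ {o = M} (cong suc (m≡m%n+[m/n]*n l M)) ⟩
      (suc (l % M) + l / M * M) / M     ≡⟨ +-distrib-/-∣ʳ (suc (l % M)) (n∣m*n (l / M)) ⟩
      suc (l % M) / M + l / M * M / M   ≡⟨ cong₂ _+_ (m<n⇒m/n≡0 1+r<M) (m*n/n≡m (l / M) M) ⟩
      l / M                             ∎
      where open ≡-Reasoning

  -- In the second case an omitted visit is jumped over.
  skip-suc : ∀ l → skip (suc l) ≡ suc (skip l) ⊎ ∃ λ j → skip l ≡ M₁ + j * m × skip (suc l) ≡ suc j * m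
  skip-suc l with suc (l % M) <? M
  ... | yes 1+r<M = inj₁ (cong (λ x → suc l + x ⊓ s) (quotient-inside-block 1+r<M))
  ... | no  1+r≮M with 1+r≡M ← ℕ.≤-antisym (m%n<n l M) (ℕ.≮⇒≥ 1+r≮M) | l / M <? s
  ...   | yes q<s = inj₂ (l / M , (begin
      l + (l / M ⊓ s)            ≡⟨ cong₂ _+_ (block-end 1+r≡M) (ℕ.m≤n⇒m⊓n≡m (ℕ.<⇒≤ q<s)) ⟩
      M₁ + l / M * M + l / M     ≡⟨ shuffle₁ M₁ (l / M) ⟩
      M₁ + l / M * m             ∎) , (begin
      suc l + (suc l / M ⊓ s)              ≡⟨ cong₂ (λ x y → x + y ⊓ s) (cong suc (block-end 1+r≡M))
                                                                       (quotient-after-block-end 1+r≡M) ⟩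
      suc (l / M) * M + (suc (l / M) ⊓ s)  ≡⟨ cong (suc (l / M) * M +_) (ℕ.m≤n⇒m⊓n≡m q<s) ⟩
      suc (l / M) * M + suc (l / M)        ≡⟨ shuffle₂ M (l / M) ⟩
      suc (l / M) * m                      ∎))
    where
    open ≡-Reasoning
    shuffle₁ : ∀ M₁ q → M₁ + q * suc M₁ + q ≡ M₁ + q * suc (suc M₁)
    shuffle₁ = solve-∀
    shuffle₂ : ∀ M q → suc q * M + suc q ≡ suc q * suc M
    shuffle₂ = solve-∀
  ...   | no  q≮s = inj₁ (cong (suc l +_) (begin
      suc l / M ⊓ s       ≡⟨ cong (_⊓ s) (quotient-after-block-end 1+r≡M) ⟩
      suc (l / M) ⊓ s     ≡⟨ ℕ.m≥n⇒m⊓n≡n (ℕ.m≤n⇒m≤1+n (ℕ.≮⇒≥ q≮s)) ⟩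
      s                   ≡⟨ ℕ.m≥n⇒m⊓n≡n (ℕ.≮⇒≥ q≮s) ⟨
      l / M ⊓ s           ∎))
    where open ≡-Reasoning

module SkipWalk {n M₁ : ℕ} (U : ClosedWalk n (suc (suc M₁))) (droppable : Droppable U M₁)
                (p s k : ℕ) (s<p : s < p) (k+s≡p*m : k + s ≡ p * suc (suc M₁)) where

  open SkipMap M₁ s
  open ClosedWalk U using () renaming (v to u; periodic to u-periodic)

  T : ℕ
  T = s * M

  private
    T+m≤k : T + m ≤ k
    T+m≤k = ℕ.+-cancelʳ-≤ s (T + m) k (begin
      s * M + m + s   ≡⟨ shuffle s M ⟩
      suc s * m       ≤⟨ ℕ.*-monoˡ-≤ m s<p ⟩
      p * m           ≡⟨ k+s≡p*m ⟨
      k + s           ∎)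
      where
      open ℕ.≤-Reasoning
      shuffle : ∀ s M → s * M + suc M + s ≡ suc s * suc M
      shuffle = solve-∀

    T≤k : T ≤ k
    T≤k = ℕ.≤-trans (ℕ.m≤m+n T m) T+m≤k

    m≤k : m ≤ k
    m≤k = ℕ.≤-trans (ℕ.m≤n+m m T) T+m≤k

    M≤k : M ≤ k
    M≤k = ℕ.≤-trans (ℕ.n≤1+n M) m≤k

    instance
      k-nonZero : NonZero k
      k-nonZero = >-nonZero (ℕ.<-≤-trans (s≤s z≤n) m≤k)

    skip[k] : skip k ≡ p * m
    skip[k] = trans (skip-late T≤k) k+s≡p*m

    u[pm+z]≡u[z] : ∀ z → u (p * m + z) ≡ u z
    u[pm+z]≡u[z] z = trans (cong u (ℕ.+-comm (p * m) z)) (periodic-* U p z)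

  w : ℕ → Fin n
  w i = u (skip (i % k))

  w-periodic : ∀ i → w (i + k) ≡ w i
  w-periodic i = cong (u ∘ skip) ([m+n]%n≡m%n i k)

  w≡u∘skip : ∀ {l} → l ≤ k → w l ≡ u (skip l)
  w≡u∘skip {l} l≤k with ℕ.m≤n⇒m<n∨m≡n l≤k
  ... | inj₁ l<k  = cong (u ∘ skip) (m<n⇒m%n≡m l<k)
  ... | inj₂ refl = begin
    u (skip (k % k))      ≡⟨ cong (u ∘ skip) (n%n≡0 k) ⟩
    u 0                   ≡⟨ u[pm+z]≡u[z] 0 ⟨
    u (p * m + 0)         ≡⟨ cong u (ℕ.+-identityʳ (p * m)) ⟩
    u (p * m)             ≡⟨ cong u skip[k] ⟨
    u (skip k)            ∎
    where open ≡-Reasoning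

  -- The position in u of the l-th visit of w, for l ≤ k + k.
  lift : ℕ → ℕ
  lift l = skip (l ⊓ k) + skip (l ∸ k)

  lift-mono : ∀ {a b} → a ≤ b → lift a ≤ lift b
  lift-mono a≤b = ℕ.+-mono-≤ (skip-mono (ℕ.⊓-monoˡ-≤ k a≤b)) (skip-mono (ℕ.∸-monoˡ-≤ k a≤b))

  lift-first : ∀ {l} → l ≤ k → lift l ≡ skip l
  lift-first {l} l≤k = trans (cong₂ (λ a b → skip a + skip b) (ℕ.m≤n⇒m⊓n≡m l≤k) (ℕ.m≤n⇒m∸n≡0 l≤k))
                             (ℕ.+-identityʳ (skip l))

  lift-second : ∀ {l} → k ≤ l → lift l ≡ p * m + skip (l ∸ k)
  lift-second {l} k≤l = cong (_+ skip (l ∸ k)) (trans (cong skip (ℕ.m≥n⇒m⊓n≡n k≤l)) skip[k])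

  w≡u∘lift : ∀ {l} → l ≤ k + k → w l ≡ u (lift l)
  w≡u∘lift {l} l≤2k with l ≤? k
  ... | yes l≤k = trans (w≡u∘skip l≤k) (cong u (sym (lift-first l≤k)))
  ... | no  l≰k = begin
    w l                       ≡⟨ cong w (ℕ.m∸n+n≡m k≤l) ⟨
    w (l ∸ k + k)             ≡⟨ w-periodic (l ∸ k) ⟩
    w (l ∸ k)                 ≡⟨ w≡u∘skip (ℕ.m≤n+o⇒m∸n≤o l k l≤2k) ⟩
    u (skip (l ∸ k))          ≡⟨ u[pm+z]≡u[z] (skip (l ∸ k)) ⟨
    u (p * m + skip (l ∸ k))  ≡⟨ cong u (lift-second k≤l) ⟨
    u (lift l)                ∎
    where
    open ≡-Reasoning
    k≤l : k ≤ l
    k≤l = ℕ.<⇒≤ (ℕ.≰⇒> l≰k)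

  -- Past the omitted visits w runs in step with u, also across the end of
  -- its period until the next omission.
  lift-late : ∀ {l} → T ≤ l → l < k + M → lift l ≡ l + s
  lift-late {l} T≤l l<k+M with l ≤? k
  ... | yes l≤k = trans (lift-first l≤k) (skip-late T≤l)
  ... | no  l≰k = begin
    lift l                  ≡⟨ lift-second k≤l ⟩
    p * m + skip (l ∸ k)    ≡⟨ cong (p * m +_) (skip-small l∸k<M) ⟩
    p * m + (l ∸ k)         ≡⟨ cong (_+ (l ∸ k)) k+s≡p*m ⟨
    k + s + (l ∸ k)         ≡⟨ +-right-comm k s (l ∸ k) ⟩
    k + (l ∸ k) + s         ≡⟨ cong (_+ s) (ℕ.m+[n∸m]≡n k≤l) ⟩
    l + s                   ∎
    where
    open ≡-Reasoning
    k≤l : k ≤ l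
    k≤l = ℕ.<⇒≤ (ℕ.≰⇒> l≰k)
    l∸k<M : l ∸ k < M
    l∸k<M = ℕ.+-cancelˡ-< k (l ∸ k) M (subst (_< k + M) (sym (ℕ.m+[n∸m]≡n k≤l)) l<k+M)

  u∘skip-adjacent : ∀ i → ¬ u (skip i) ≡ u (skip (suc i))
  u∘skip-adjacent i eq with skip-suc i
  ... | inj₁ skip[1+i]≡1+skip[i] = adjacent-everywhere U (skip i) (trans eq (cong u skip[1+i]≡1+skip[i]))
  ... | inj₂ (j , skip[i]≡M₁+jm , skip[1+i]≡[1+j]m) = proj₁ droppable (begin
    u M₁                  ≡⟨ periodic-* U j M₁ ⟨
    u (M₁ + j * m)        ≡⟨ cong u skip[i]≡M₁+jm ⟨
    u (skip i)            ≡⟨ eq ⟩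
    u (skip (suc i))      ≡⟨ cong u skip[1+i]≡[1+j]m ⟩
    u (m + j * m)         ≡⟨ periodic-* U j m ⟩
    u m                   ∎)
    where open ≡-Reasoning

  w-adjacent : ∀ i → i < k → ¬ w i ≡ w (suc i)
  w-adjacent i i<k w[i]≡w[1+i] =
    u∘skip-adjacent i (trans (sym (w≡u∘skip (ℕ.<⇒≤ i<k))) (trans w[i]≡w[1+i] (w≡u∘skip i<k)))

  w-covers : ∀ d → ∃ λ i → i < k × w i ≡ d
  w-covers d with covers-window U (k ∸ m + s) d
  ... | z , z<m , u[k-m+s+z]≡d = k ∸ m + z , i<k , (begin
    w (k ∸ m + z)           ≡⟨ w≡u∘skip (ℕ.<⇒≤ i<k) ⟩
    u (skip (k ∸ m + z))    ≡⟨ cong u (skip-late T≤i) ⟩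
    u (k ∸ m + z + s)       ≡⟨ cong u (+-right-comm (k ∸ m) z s) ⟩
    u (k ∸ m + s + z)       ≡⟨ u[k-m+s+z]≡d ⟩
    d                       ∎)
    where
    open ≡-Reasoning
    i<k : k ∸ m + z < k
    i<k = ℕ.<-≤-trans (ℕ.+-monoʳ-< (k ∸ m) z<m) (ℕ.≤-reflexive (ℕ.m∸n+n≡m m≤k))
    T≤i : T ≤ k ∸ m + z
    T≤i = ℕ.≤-trans (ℕ.m+n≤o⇒m≤o∸n T T+m≤k) (ℕ.m≤m+n (k ∸ m) z)

  skipWalk : ClosedWalk n k
  skipWalk = record { v = w ; periodic = w-periodic ; adjacent = w-adjacent ; covers = w-covers }

  RevisitedWithinPeriod : ℕ → Set
  RevisitedWithinPeriod i = ∃ λ t → 0 < t × t ≤ k × w (i + t) ≡ w i × lift (i + t) ≤ lift i + m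

  private
    one-period-later : ∀ {i t} → i + t ≤ k + k → lift (i + t) ≡ lift i + m → w (i + t) ≡ w i
    one-period-later {i} {t} i+t≤2k lift-eq = begin
      w (i + t)          ≡⟨ w≡u∘lift i+t≤2k ⟩
      u (lift (i + t))   ≡⟨ cong u lift-eq ⟩
      u (lift i + m)     ≡⟨ u-periodic (lift i) ⟩
      u (lift i)         ≡⟨ w≡u∘lift (ℕ.≤-trans (ℕ.m≤m+n i t) i+t≤2k) ⟨
      w i                ∎
      where open ≡-Reasoning

    revisit-early : ∀ {i} → i < T → RevisitedWithinPeriod i
    revisit-early {i} i<T =
      M , s≤s z≤n , M≤k ,
      one-period-later (ℕ.≤-trans i+M≤k (ℕ.m≤m+n k k)) lift-eq , ℕ.≤-reflexive lift-eq
      where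
      i+M≤k : i + M ≤ k
      i+M≤k = ℕ.≤-trans (ℕ.<⇒≤ (ℕ.+-monoˡ-< M i<T)) (ℕ.≤-trans (ℕ.+-monoʳ-≤ T (ℕ.n≤1+n M)) T+m≤k)
      lift-eq : lift (i + M) ≡ lift i + m
      lift-eq = trans (lift-first i+M≤k) (trans (skip-early-+M i<T)
                      (cong (_+ m) (sym (lift-first (ℕ.≤-trans (ℕ.m≤m+n i M) i+M≤k)))))

    revisit-late : ∀ {i} → T ≤ i → suc i < k → RevisitedWithinPeriod i
    revisit-late {i} T≤i 1+i<k =
      m , s≤s z≤n , m≤k ,
      one-period-later (ℕ.≤-trans (ℕ.<⇒≤ i+m<k+M) (ℕ.+-monoʳ-≤ k M≤k)) lift-eq ,
      ℕ.≤-reflexive lift-eq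
      where
      i+m<k+M : i + m < k + M
      i+m<k+M = ℕ.≤-<-trans (ℕ.≤-reflexive (ℕ.+-suc i M)) (ℕ.+-monoˡ-< M 1+i<k)
      lift-eq : lift (i + m) ≡ lift i + m
      lift-eq = begin
        lift (i + m)   ≡⟨ lift-late (ℕ.≤-trans T≤i (ℕ.m≤m+n i m)) i+m<k+M ⟩
        i + m + s      ≡⟨ +-right-comm i m s ⟩
        i + s + m      ≡⟨ cong (_+ m) (lift-late T≤i (ℕ.<-≤-trans (ℕ.<-trans (ℕ.n<1+n i) 1+i<k) (ℕ.m≤m+n k M))) ⟨
        lift i + m     ∎
        where open ≡-Reasoning

    -- The last visit of w is to u M, which the next s rounds omit; being
    -- droppable, it recurs earlier, within a period of u.
    revisit-across-end : ∀ {i} → T ≤ i → suc i ≡ k → RevisitedWithinPeriod i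
    revisit-across-end {i} T≤i 1+i≡k with proj₂ droppable
    ... | t , t<m , 0<t , u[M+t]≡u[M] =
      t , 0<t , ℕ.≤-trans (ℕ.<⇒≤ t<m) m≤k , w-eq , lift-≤
      where
      open ≡-Reasoning
      i+t<k+M : i + t < k + M
      i+t<k+M = ℕ.<-≤-trans (ℕ.+-monoʳ-< i t<m) (ℕ.≤-reflexive (trans (ℕ.+-suc i M) (cong (_+ M) 1+i≡k)))
      i<k : i < k
      i<k = ℕ.≤-reflexive 1+i≡k
      lift[i] : lift i ≡ i + s
      lift[i] = lift-late T≤i (ℕ.<-≤-trans i<k (ℕ.m≤m+n k M))
      lift[i+t] : lift (i + t) ≡ i + s + t
      lift[i+t] = trans (lift-late (ℕ.≤-trans T≤i (ℕ.m≤m+n i t)) i+t<k+M) (+-right-comm i t s)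
      lift-≤ : lift (i + t) ≤ lift i + m
      lift-≤ = ℕ.≤-trans (ℕ.≤-reflexive lift[i+t]) (ℕ.≤-trans (ℕ.+-monoʳ-≤ (i + s) (ℕ.<⇒≤ t<m))
                                                               (ℕ.≤-reflexive (cong (_+ m) (sym lift[i]))))
      u[i+s+z]≡u[M+z] : ∀ z → u (i + s + z) ≡ u (M + z)
      u[i+s+z]≡u[M+z] z = begin
        u (i + s + z)                ≡⟨ u-periodic (i + s + z) ⟨
        u (i + s + z + m)            ≡⟨ cong u (shuffle i s z M) ⟩
        u (suc i + s + (M + z))      ≡⟨ cong (λ x → u (x + s + (M + z))) 1+i≡k ⟩
        u (k + s + (M + z))          ≡⟨ cong (λ x → u (x + (M + z))) k+s≡p*m ⟩
        u (p * m + (M + z))          ≡⟨ u[pm+z]≡u[z] (M + z) ⟩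
        u (M + z)                    ∎
        where
        shuffle : ∀ i s z M → i + s + z + suc M ≡ suc i + s + (M + z)
        shuffle = solve-∀
      w-eq : w (i + t) ≡ w i
      w-eq = begin
        w (i + t)         ≡⟨ w≡u∘lift (ℕ.≤-trans (ℕ.<⇒≤ i+t<k+M) (ℕ.+-monoʳ-≤ k M≤k)) ⟩
        u (lift (i + t))  ≡⟨ cong u lift[i+t] ⟩
        u (i + s + t)     ≡⟨ u[i+s+z]≡u[M+z] t ⟩
        u (M + t)         ≡⟨ u[M+t]≡u[M] ⟩
        u M               ≡⟨ cong u (ℕ.+-identityʳ M) ⟨
        u (M + 0)         ≡⟨ u[i+s+z]≡u[M+z] 0 ⟨
        u (i + s + 0)     ≡⟨ cong u (ℕ.+-identityʳ (i + s)) ⟩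
        u (i + s)         ≡⟨ cong u lift[i] ⟨
        u (lift i)        ≡⟨ w≡u∘lift (ℕ.≤-trans (ℕ.<⇒≤ i<k) (ℕ.m≤m+n k k)) ⟨
        w i               ∎

  revisit-within-period : ∀ i → i < k → RevisitedWithinPeriod i
  revisit-within-period i i<k with i <? T
  ... | yes i<T = revisit-early i<T
  ... | no  i≮T with suc i <? k
  ...   | yes 1+i<k = revisit-late (ℕ.≮⇒≥ i≮T) 1+i<k
  ...   | no  1+i≮k = revisit-across-end (ℕ.≮⇒≥ i≮T) (ℕ.≤-antisym i<k (ℕ.≮⇒≥ 1+i≮k))

shortened-repetition :
  ∀ {n M₁} (c : TravelTimes n) → (∀ x y → 0ℚ ≤ℚ c x y) → (∀ x → c x x ≡ 0ℚ) →
  (∀ x y z → c x z ≤ℚ c x y +ℚ c y z) →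
  (W′ : ClosedWalk n (suc (suc M₁))) → let m = suc (suc M₁) in
  n < m → m < n + n → 2 < n ⊎ m ≡ 3 →
  ∀ p s k → s < p → k + s ≡ p * m →
  ∃ λ (W : ClosedWalk n k) → revisitTime c W ≤ℚ revisitTime c W′
shortened-repetition {n} {M₁} c c-nonneg c-refl triangle W′ n<m m<2n n>2⊎m≡3 p s k s<p k+s≡p*m
  with ∃-unrevisited W′ m<2n | ∃-droppable W′ n<m n>2⊎m≡3
... | i₀ , i₀<m , unrevisited | e , droppable = skipWalk , (begin
  revisitTime c skipWalk           ≤⟨ revisitTime≤period c c-nonneg c-refl triangle skipWalk
                                        (ClosedWalk.periodic U) lift lift-mono w≡u∘lift revisit-within-period ⟩
  pathLength c u 0 m               ≡⟨ pathLength-shift c v′ (suc (suc e)) 0 m ⟩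
  pathLength c v′ (suc (suc e)) m  ≡⟨ pathLength-rotate c (ClosedWalk.periodic W′) (suc (suc e)) ⟩
  pathLength c v′ 0 m              ≡⟨ pathLength-rotate c (ClosedWalk.periodic W′) i₀ ⟨
  pathLength c v′ i₀ m             ≤⟨ period≤gap c W′ unrevisited ⟩
  gap c W′ i₀                      ≤⟨ gap≤revisitTime c W′ i₀ i₀<m ⟩
  revisitTime c W′                 ∎)
  where
  open ℚ.≤-Reasoning
  m : ℕ
  m = suc (suc M₁)
  v′ : ℕ → Fin n
  v′ = ClosedWalk.v W′
  U : ClosedWalk n m
  U = rotate W′ (suc (suc e))
  u : ℕ → Fin n
  u = ClosedWalk.v U
  droppable-at-end : Droppable U M₁
  droppable-at-end = droppable-rotate W′ {M₁} {suc (suc e)}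
                       (subst (Droppable W′) (shuffle e M₁) (droppable-+m W′ droppable))
    where
    shuffle : ∀ e M₁ → e + suc (suc M₁) ≡ M₁ + suc (suc e)
    shuffle = solve-∀
  open SkipWalk U droppable-at-end p s k s<p k+s≡p*m

ceilDiv-bounds : ∀ {p q} → 1 ≤ p → 1 ≤ q →
                 1 ≤ ceilDiv q p × ceilDiv q p ≤ q × q ≤ p * ceilDiv q p × p * ceilDiv q p < q + p
ceilDiv-bounds {suc p₁} {q@(suc _)} _ _ = 1≤r , r≤q , q≤pr , pr<q+p
  where
  open ℕ.≤-Reasoning
  p r : ℕ
  p = suc p₁
  r = (q + p₁) / p
  1≤r : 1 ≤ r
  1≤r = m≥n⇒m/n>0 (ℕ.+-monoˡ-≤ p₁ (s≤s z≤n))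
  r≤q : r ≤ q
  r≤q = begin
    (q + p₁) / p     ≤⟨ /-monoˡ-≤ p (ℕ.+-monoʳ-≤ q (ℕ.m≤n*m p₁ q)) ⟩
    (q + q * p₁) / p ≡⟨ /-congˡ {o = p} (ℕ.*-suc q p₁) ⟨
    q * p / p        ≡⟨ m*n/n≡m q p ⟩
    q                ∎
  q≤pr : q ≤ p * r
  q≤pr = ℕ.+-cancelʳ-≤ p₁ q (p * r) (begin
    q + p₁                 ≡⟨ m≡m%n+[m/n]*n (q + p₁) p ⟩
    (q + p₁) % p + r * p   ≤⟨ ℕ.+-monoˡ-≤ (r * p) (ℕ.≤-pred (m%n<n (q + p₁) p)) ⟩
    p₁ + r * p             ≡⟨ ℕ.+-comm p₁ (r * p) ⟩
    r * p + p₁             ≡⟨ cong (_+ p₁) (ℕ.*-comm r p) ⟩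
    p * r + p₁             ∎)
  pr<q+p : p * r < q + p
  pr<q+p = begin-strict
    p * r      ≡⟨ ℕ.*-comm p r ⟩
    r * p      ≤⟨ m/n*n≤m (q + p₁) p ⟩
    q + p₁     <⟨ ℕ.+-monoʳ-< q (ℕ.n<1+n p₁) ⟩
    q + p      ∎

ceilDiv-shortfall : ∀ {p q} n → 1 ≤ p → 1 ≤ q → ∃ λ s → s < p × p * n + q + s ≡ p * (n + ceilDiv q p)
ceilDiv-shortfall {p} {q} n 1≤p 1≤q with ceilDiv-bounds 1≤p 1≤q
... | _ , _ , q≤pr , pr<q+p = p * r ∸ q , s<p , (begin
  p * n + q + (p * r ∸ q)     ≡⟨ ℕ.+-assoc (p * n) q (p * r ∸ q) ⟩
  p * n + (q + (p * r ∸ q))   ≡⟨ cong (p * n +_) (ℕ.m+[n∸m]≡n q≤pr) ⟩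
  p * n + p * r               ≡⟨ ℕ.*-distribˡ-+ p n r ⟨
  p * (n + r)                 ∎)
  where
  open ≡-Reasoning
  r : ℕ
  r = ceilDiv q p
  s<p : p * r ∸ q < p
  s<p = ℕ.+-cancelʳ-< q (p * r ∸ q) p
          (subst₂ _<_ (sym (ℕ.m∸n+n≡m q≤pr)) (ℕ.+-comm q p) pr<q+p)

n>2⊎m≡3 : ∀ {n₂ r} → 1 ≤ r → r < 2 + n₂ → 2 < 2 + n₂ ⊎ 2 + n₂ + r ≡ 3
n>2⊎m≡3 {zero}  (s≤s z≤n) (s≤s (s≤s z≤n)) = inj₂ refl
n>2⊎m≡3 {suc _} _         _               = inj₁ (s≤s (s≤s (s≤s z≤n)))

travelTime-nonneg : ∀ {n} (c : TravelTimes n) → (∀ x → c x x ≡ 0ℚ) →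
                    (∀ x y → ¬ x ≡ y → 0ℚ <ℚ c x y) → ∀ x y → 0ℚ ≤ℚ c x y
travelTime-nonneg c c-refl c-pos x y with x Fin.≟ y
... | yes refl = ℚ.≤-reflexive (sym (c-refl x))
... | no  x≢y  = ℚ.<⇒≤ (c-pos x y x≢y)

lemma10 : (n : ℕ) → 2 ≤ n → (c : TravelTimes n) →
          (∀ u → c u u ≡ 0ℚ) →
          (∀ u v → ¬ (u ≡ v) → 0ℚ <ℚ c u v) →
          (∀ u v w → c u w ≤ℚ c u v +ℚ c v w) →
          (k p q : ℕ) → k ≡ p * n + q → 1 ≤ p → 1 ≤ q → q < n →
          (W' : ClosedWalk n (n + ceilDiv q p)) →
          ∃ λ (W : ClosedWalk n k) → revisitTime c W ≤ℚ revisitTime c W'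
lemma10 n@(suc (suc n₂)) (s≤s (s≤s z≤n)) c c-refl c-pos triangle .(p * n + q) p q refl 1≤p 1≤q q<n W′
  with ceilDiv-bounds 1≤p 1≤q | ceilDiv-shortfall n 1≤p 1≤q
... | 1≤r , r≤q , _ | s , s<p , k+s≡p*m =
  shortened-repetition c (travelTime-nonneg c c-refl c-pos) c-refl triangle W′
    (ℕ.≤-trans (ℕ.≤-reflexive (ℕ.+-comm 1 n)) (ℕ.+-monoʳ-≤ n 1≤r))
    (ℕ.+-monoʳ-< n r<n) (n>2⊎m≡3 1≤r r<n) p s (p * n + q) s<p k+s≡p*m
  where
  r<n : ceilDiv q p < n
  r<n = ℕ.≤-<-trans r≤q q<n
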